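{- For every integer $j\ge 1$, letting $n=2^{2^j}+1$ be the $j$-th Fermat number, there exists a $CM(n;4;1)$, namely an $n\times n$ real matrix $C$ with $CC^{\top}=C^{\top}C=I_n$ whose entries take the four values $0,1,\frac{1}{2m},-\frac{1}{2m}$ where $4m^2=2^{2^j}$.
   Context: The notation $CM(n;\tau;\omega)$ denotes a Cretan matrix of order $n$: an $n\times n$ real matrix with entries of modulus at most $1$ satisfying $SS^{\top}=S^{\top}S=\omega I_n$, whose entries take $\tau$ distinct values (levels); $\omega$ is the radius. -}

module Defs where

open import Data.Nat using (ℕ; zero; suc; _+_; _*_; _^_)
open import Data.Fin using (Fin; zero; suc)
open import Data.Fin.Properties using (_≟_)
open import Data.Integer using (+_)
open import Data.Rational as ℚ using (ℚ; 0ℚ; 1ℚ; _/_; -_)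
open import Data.Product using (Σ; ∃; _×_; _,_)
open import Data.Sum using (_⊎_)
open import Relation.Binary.PropositionalEquality using (_≡_)
open import Relation.Nullary using (yes; no)

-- Real square matrices of order n, specialised to rational entries
Matrix : ℕ → Set
Matrix n = Fin n → Fin n → ℚ

Σℚ : ∀ n → (Fin n → ℚ) → ℚ
Σℚ zero    f = 0ℚ
Σℚ (suc n) f = f zero ℚ.+ Σℚ n (λ i → f (suc i))

transpose : ∀ {n} → Matrix n → Matrix n
transpose A i j = A j i

_⊗_ : ∀ {n} → Matrix n → Matrix n → Matrix n
_⊗_ {n} A B i j = Σℚ n (λ k → A i k ℚ.* B k j)

identity : ∀ {n} → Matrix n
identity i j with i ≟ j
... | yes _ = 1ℚ
... | no  _ = 0ℚ

fermat : ℕ → ℕ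
fermat j = 2 ^ (2 ^ j) + 1

-- the rational 1/(2m); (m = 0 never occurs under the hypotheses, value irrelevant there)
inv2m : ℕ → ℚ
inv2m zero    = 0ℚ
inv2m (suc k) = + 1 / (2 * suc k)

IsCretan : ∀ {n} → ℚ → Matrix n → Set
IsCretan ω S =
  (∀ i j → ℚ.∣ S i j ∣ ℚ.≤ 1ℚ) ×
  (∀ i j → (S ⊗ transpose S) i j ≡ ω ℚ.* identity i j) ×
  (∀ i j → (transpose S ⊗ S) i j ≡ ω ℚ.* identity i j)

FourLevels : ∀ {n} → ℕ → Matrix n → Set
FourLevels {n} m S =
  (∀ i j → S i j ≡ 0ℚ ⊎ S i j ≡ 1ℚ ⊎ S i j ≡ inv2m m ⊎ S i j ≡ - inv2m m) ×
  (∃ λ i → ∃ λ j → S i j ≡ 0ℚ) ×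
  (∃ λ i → ∃ λ j → S i j ≡ 1ℚ) ×
  (∃ λ i → ∃ λ j → S i j ≡ inv2m m) ×
  (∃ λ i → ∃ λ j → S i j ≡ - inv2m m)

-- Let H be Sylvester's Hadamard matrix of order N = 2^(2^j) = 4m², built from (1) by
-- H ↦ [ H H ; H -H ]; it is a symmetric ±1 matrix with H Hᵀ = N I. The bordered matrix
-- C = [ 1 0 ; 0 H/(2m) ] is then symmetric with C Cᵀ = I because N/(2m)² = 1, its order
-- N + 1 is the Fermat number, and its entries are exactly 0, 1 and ±1/(2m).

module Submission where

open import Data.Empty using (⊥-elim)
open import Data.Fin using (Fin; zero; suc; splitAt; join; _↑ˡ_; _↑ʳ_)
open import Data.Fin.Properties
  using (_≟_; splitAt-↑ˡ; splitAt-↑ʳ; splitAt-join; join-splitAt; ↑ˡ-injective; ↑ʳ-injective; suc-injective)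
import Data.Integer as ℤ
import Data.Integer.Properties as ℤ
open import Data.Nat as ℕ using (ℕ; zero; suc; _^_; _≤_)
import Data.Nat.Properties as ℕₚ
open import Data.Nat.Solver renaming (module +-*-Solver to ℕSolver)
open import Data.Product using (Σ; ∃; _×_; _,_)
open import Function using (_∘_)
open import Data.Rational as ℚ using (ℚ; 0ℚ; 1ℚ; _/_; -_; _+_; _*_; toℚᵘ; fromℚᵘ)
open import Data.Rational.Properties hiding (_≟_)
open import Data.Rational.Solver renaming (module +-*-Solver to ℚSolver)
import Data.Rational.Unnormalised as ℚᵘ
import Data.Rational.Unnormalised.Properties as ℚᵘ
open import Data.Sum using (_⊎_; inj₁; inj₂)
open import Relation.Binary.PropositionalEquality
open import Relation.Nullary using (yes; no)

open import Defs

ι : ℕ → ℚ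
ι n = ℤ.+ n / 1

-- ℚ is normalised, so identities are proved in ℚᵘ and transported along fromℚᵘ.
fromℚᵘ-homo-+ : ∀ p q → fromℚᵘ (p ℚᵘ.+ q) ≡ fromℚᵘ p + fromℚᵘ q
fromℚᵘ-homo-+ p q = toℚᵘ-injective (ℚᵘ.≃-trans (toℚᵘ-fromℚᵘ (p ℚᵘ.+ q))
  (ℚᵘ.≃-trans (ℚᵘ.+-cong (ℚᵘ.≃-sym (toℚᵘ-fromℚᵘ p)) (ℚᵘ.≃-sym (toℚᵘ-fromℚᵘ q)))
              (ℚᵘ.≃-sym (toℚᵘ-homo-+ (fromℚᵘ p) (fromℚᵘ q)))))

fromℚᵘ-homo-* : ∀ p q → fromℚᵘ (p ℚᵘ.* q) ≡ fromℚᵘ p * fromℚᵘ q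
fromℚᵘ-homo-* p q = toℚᵘ-injective (ℚᵘ.≃-trans (toℚᵘ-fromℚᵘ (p ℚᵘ.* q))
  (ℚᵘ.≃-trans (ℚᵘ.*-cong (ℚᵘ.≃-sym (toℚᵘ-fromℚᵘ p)) (ℚᵘ.≃-sym (toℚᵘ-fromℚᵘ q)))
              (ℚᵘ.≃-sym (toℚᵘ-homo-* (fromℚᵘ p) (fromℚᵘ q)))))

ιᵘ : ℕ → ℚᵘ.ℚᵘ
ιᵘ n = ℤ.+ n ℚᵘ./ 1

ι-homo-+ : ∀ m n → ι (m ℕ.+ n) ≡ ι m + ι n
ι-homo-+ m n =
  trans (fromℚᵘ-cong {ιᵘ (m ℕ.+ n)} {ιᵘ m ℚᵘ.+ ιᵘ n} (ℚᵘ.*≡* eq)) (fromℚᵘ-homo-+ (ιᵘ m) (ιᵘ n))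
  where
  eq : ℤ.+ (m ℕ.+ n) ℤ.* ℤ.+ 1 ≡ (ℤ.+ m ℤ.* ℤ.+ 1 ℤ.+ ℤ.+ n ℤ.* ℤ.+ 1) ℤ.* ℤ.+ 1
  eq = cong (ℤ._* ℤ.+ 1)
    (trans (ℤ.pos-+ m n) (sym (cong₂ ℤ._+_ (ℤ.*-identityʳ (ℤ.+ m)) (ℤ.*-identityʳ (ℤ.+ n)))))

ι-homo-* : ∀ m n → ι (m ℕ.* n) ≡ ι m * ι n
ι-homo-* m n =
  trans (fromℚᵘ-cong {ιᵘ (m ℕ.* n)} {ιᵘ m ℚᵘ.* ιᵘ n} (ℚᵘ.*≡* (cong (ℤ._* ℤ.+ 1) (ℤ.pos-* m n))))
        (fromℚᵘ-homo-* (ιᵘ m) (ιᵘ n))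

inv2m-inverse : ∀ k → inv2m (suc k) * ι (2 ℕ.* suc k) ≡ 1ℚ
inv2m-inverse k = trans (sym (fromℚᵘ-homo-* (ℚᵘ.1/ d) d)) (fromℚᵘ-cong (ℚᵘ.*-inverseˡ d))
  where
  d : ℚᵘ.ℚᵘ
  d = ιᵘ (2 ℕ.* suc k)

inv2m-square : ∀ k → inv2m (suc k) * inv2m (suc k) * ι (4 ℕ.* (suc k ℕ.* suc k)) ≡ 1ℚ
inv2m-square k = begin
  x * x * ι (4 ℕ.* (suc k ℕ.* suc k))        ≡⟨ cong (λ N → x * x * ι N) (square-double (suc k)) ⟩
  x * x * ι (2 ℕ.* suc k ℕ.* (2 ℕ.* suc k))  ≡⟨ cong (x * x *_) (ι-homo-* (2 ℕ.* suc k) (2 ℕ.* suc k)) ⟩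
  x * x * (y * y)                            ≡⟨ regroup x y ⟩
  (x * y) * (x * y)                          ≡⟨ cong₂ _*_ (inv2m-inverse k) (inv2m-inverse k) ⟩
  1ℚ                                         ∎
  where
  open ≡-Reasoning
  x y : ℚ
  x = inv2m (suc k)
  y = ι (2 ℕ.* suc k)
  square-double : ∀ m → 4 ℕ.* (m ℕ.* m) ≡ 2 ℕ.* m ℕ.* (2 ℕ.* m)
  square-double = solve 1 (λ m → con 4 :* (m :* m) := con 2 :* m :* (con 2 :* m)) refl
    where open ℕSolver
  regroup : ∀ x y → x * x * (y * y) ≡ (x * y) * (x * y)
  regroup = solve 2 (λ x y → x :* x :* (y :* y) := (x :* y) :* (x :* y)) refl
    where open ℚSolver

∣inv2m∣≤1 : ∀ m → ℚ.∣ inv2m m ∣ ℚ.≤ 1ℚ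
∣inv2m∣≤1 zero    = nonNegative⁻¹ 1ℚ
∣inv2m∣≤1 (suc k) = subst (ℚ._≤ 1ℚ) (sym (0≤p⇒∣p∣≡p 0≤x)) x≤1
  where
  x≃ : toℚᵘ (inv2m (suc k)) ℚᵘ.≃ ℚᵘ.1/ ιᵘ (2 ℕ.* suc k)
  x≃ = toℚᵘ-fromℚᵘ _
  0≤x : 0ℚ ℚ.≤ inv2m (suc k)
  0≤x = toℚᵘ-cancel-≤ (ℚᵘ.≤-respʳ-≃ (ℚᵘ.≃-sym x≃) (ℚᵘ.*≤* (ℤ.+≤+ ℕ.z≤n)))
  x≤1 : inv2m (suc k) ℚ.≤ 1ℚ
  x≤1 = toℚᵘ-cancel-≤ (ℚᵘ.≤-respˡ-≃ (ℚᵘ.≃-sym x≃) (ℚᵘ.*≤* (ℤ.+≤+ (ℕ.s≤s ℕ.z≤n))))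

Σℚ-cong : ∀ n {f g : Fin n → ℚ} → (∀ i → f i ≡ g i) → Σℚ n f ≡ Σℚ n g
Σℚ-cong zero    f≗g = refl
Σℚ-cong (suc n) f≗g = cong₂ _+_ (f≗g zero) (Σℚ-cong n (λ i → f≗g (suc i)))

Σℚ-++ : ∀ m n (f : Fin (m ℕ.+ n) → ℚ) →
        Σℚ (m ℕ.+ n) f ≡ Σℚ m (λ i → f (i ↑ˡ n)) + Σℚ n (λ i → f (m ↑ʳ i))
Σℚ-++ zero    n f = sym (+-identityˡ _)
Σℚ-++ (suc m) n f =
  trans (cong (f zero +_) (Σℚ-++ m n (λ i → f (suc i)))) (sym (+-assoc (f zero) _ _))

Σℚ-*ˡ : ∀ n c (f : Fin n → ℚ) → Σℚ n (λ i → c * f i) ≡ c * Σℚ n f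
Σℚ-*ˡ zero    c f = sym (*-zeroʳ c)
Σℚ-*ˡ (suc n) c f =
  trans (cong (c * f zero +_) (Σℚ-*ˡ n c (λ i → f (suc i)))) (sym (*-distribˡ-+ c (f zero) _))

Σℚ-neg : ∀ n (f : Fin n → ℚ) → Σℚ n (λ i → - f i) ≡ - Σℚ n f
Σℚ-neg zero    f = refl
Σℚ-neg (suc n) f =
  trans (cong (- f zero +_) (Σℚ-neg n (λ i → f (suc i)))) (sym (neg-distrib-+ (f zero) _))

Σℚ-zero : ∀ n → Σℚ n (λ _ → 0ℚ) ≡ 0ℚ
Σℚ-zero zero    = refl
Σℚ-zero (suc n) = trans (+-identityˡ _) (Σℚ-zero n)

IsSign : ℚ → Set
IsSign x = x ≡ 1ℚ ⊎ x ≡ - 1ℚ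

IsSignMatrix : ∀ {n} → Matrix n → Set
IsSignMatrix H = ∀ i j → IsSign (H i j)

IsSymmetric : ∀ {n} → Matrix n → Set
IsSymmetric A = ∀ i j → A i j ≡ A j i

HasOrthogonalRows : ∀ {n} → ℚ → Matrix n → Set
HasOrthogonalRows c A = ∀ i j → (A ⊗ transpose A) i j ≡ c * identity i j

Contains : ∀ {n} → ℚ → Matrix n → Set
Contains x A = ∃ λ i → ∃ λ j → A i j ≡ x

-‿IsSign : ∀ {x} → IsSign x → IsSign (- x)
-‿IsSign (inj₁ refl) = inj₂ refl
-‿IsSign (inj₂ refl) = inj₁ refl

identity-diag : ∀ {n} (i : Fin n) → identity i i ≡ 1ℚ
identity-diag i with i ≟ i
... | yes _  = refl
... | no i≢i = ⊥-elim (i≢i refl)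

identity-off : ∀ {n} {i j : Fin n} → i ≢ j → identity i j ≡ 0ℚ
identity-off {i = i} {j} i≢j with i ≟ j
... | yes i≡j = ⊥-elim (i≢j i≡j)
... | no _    = refl

identity-injective : ∀ {m n} (f : Fin m → Fin n) → (∀ {a b} → f a ≡ f b → a ≡ b) →
                     ∀ a b → identity (f a) (f b) ≡ identity a b
identity-injective f f-inj a b with a ≟ b
... | yes refl = identity-diag (f a)
... | no a≢b   = identity-off (λ fa≡fb → a≢b (f-inj fa≡fb))

↑ˡ≢↑ʳ : ∀ {m n} (a : Fin m) (b : Fin n) → a ↑ˡ n ≢ m ↑ʳ b
↑ˡ≢↑ʳ {m} {n} a b eq with trans (sym (splitAt-↑ˡ m a n)) (trans (cong (splitAt m) eq) (splitAt-↑ʳ m n b))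
... | ()

symmetric⇒ᵀ⊗≡⊗ᵀ : ∀ {n} {A : Matrix n} → IsSymmetric A →
                   ∀ i j → (transpose A ⊗ A) i j ≡ (A ⊗ transpose A) i j
symmetric⇒ᵀ⊗≡⊗ᵀ {n} sym-A i j = Σℚ-cong n (λ k → cong₂ _*_ (sym-A k i) (sym-A k j))

blocks : ∀ {n} → Matrix n → Fin n ⊎ Fin n → Fin n ⊎ Fin n → ℚ
blocks H (inj₁ a) (inj₁ b) = H a b
blocks H (inj₁ a) (inj₂ b) = H a b
blocks H (inj₂ a) (inj₁ b) = H a b
blocks H (inj₂ a) (inj₂ b) = - H a b

doubled : ∀ {n} → Matrix n → Matrix (n ℕ.+ n)
doubled {n} H i j = blocks H (splitAt n i) (splitAt n j)

module _ {n : ℕ} (H : Matrix n) where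

  doubled-join : ∀ s t → doubled H (join n n s) (join n n t) ≡ blocks H s t
  doubled-join s t = cong₂ (blocks H) (splitAt-join n n s) (splitAt-join n n t)

  doubled-sign : IsSignMatrix H → IsSignMatrix (doubled H)
  doubled-sign sign-H i j = blocks-sign (splitAt n i) (splitAt n j)
    where
    blocks-sign : ∀ s t → IsSign (blocks H s t)
    blocks-sign (inj₁ a) (inj₁ b) = sign-H a b
    blocks-sign (inj₁ a) (inj₂ b) = sign-H a b
    blocks-sign (inj₂ a) (inj₁ b) = sign-H a b
    blocks-sign (inj₂ a) (inj₂ b) = -‿IsSign (sign-H a b)

  doubled-symmetric : IsSymmetric H → IsSymmetric (doubled H)
  doubled-symmetric sym-H i j = blocks-symmetric (splitAt n i) (splitAt n j)
    where
    blocks-symmetric : ∀ s t → blocks H s t ≡ blocks H t s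
    blocks-symmetric (inj₁ a) (inj₁ b) = sym-H a b
    blocks-symmetric (inj₁ a) (inj₂ b) = sym-H a b
    blocks-symmetric (inj₂ a) (inj₁ b) = sym-H a b
    blocks-symmetric (inj₂ a) (inj₂ b) = cong -_ (sym-H a b)

  doubled-contains-1 : Contains 1ℚ H → Contains 1ℚ (doubled H)
  doubled-contains-1 (a , b , Hab≡1) = a ↑ˡ n , b ↑ˡ n , trans (doubled-join (inj₁ a) (inj₁ b)) Hab≡1

  doubled-contains-−1 : Contains 1ℚ H → Contains (- 1ℚ) (doubled H)
  doubled-contains-−1 (a , b , Hab≡1) =
    n ↑ʳ a , n ↑ʳ b , trans (doubled-join (inj₂ a) (inj₂ b)) (cong -_ Hab≡1)

  doubled-orthogonal : ∀ {c} → HasOrthogonalRows c H → HasOrthogonalRows (c + c) (doubled H)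
  doubled-orthogonal {c} orth i j =
    subst₂ (λ i j → (D ⊗ transpose D) i j ≡ (c + c) * identity i j)
      (join-splitAt n n i) (join-splitAt n n j)
      (trans (rows (splitAt n i) (splitAt n j)) (blockRows (splitAt n i) (splitAt n j)))
    where
    D : Matrix (n ℕ.+ n)
    D = doubled H
    P : Matrix n
    P = H ⊗ transpose H

    rows : ∀ s t → (D ⊗ transpose D) (join n n s) (join n n t)
                 ≡ Σℚ n (λ l → blocks H s (inj₁ l) * blocks H t (inj₁ l))
                   + Σℚ n (λ l → blocks H s (inj₂ l) * blocks H t (inj₂ l))
    rows s t = trans (Σℚ-++ n n _) (cong₂ _+_
      (Σℚ-cong n (λ l → cong₂ _*_ (doubled-join s (inj₁ l)) (doubled-join t (inj₁ l))))
      (Σℚ-cong n (λ l → cong₂ _*_ (doubled-join s (inj₂ l)) (doubled-join t (inj₂ l)))))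

    twice : (f : Fin n → Fin (n ℕ.+ n)) → (∀ {a b} → f a ≡ f b → a ≡ b) →
            ∀ a b → P a b + P a b ≡ (c + c) * identity (f a) (f b)
    twice f f-inj a b = trans (cong₂ _+_ (orth a b) (orth a b))
      (trans (sym (*-distribʳ-+ (identity a b) c c)) (cong ((c + c) *_) (sym (identity-injective f f-inj a b))))

    cancels : ∀ {i j} a b {f : Fin n → ℚ} → (∀ l → f l ≡ - (H a l * H b l)) → i ≢ j →
              P a b + Σℚ n f ≡ (c + c) * identity i j
    cancels a b f≗-HH i≢j = trans (cong (P a b +_) (trans (Σℚ-cong n f≗-HH) (Σℚ-neg n _)))
      (trans (+-inverseʳ (P a b)) (sym (trans (cong ((c + c) *_) (identity-off i≢j)) (*-zeroʳ (c + c)))))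

    blockRows : ∀ s t → Σℚ n (λ l → blocks H s (inj₁ l) * blocks H t (inj₁ l))
                        + Σℚ n (λ l → blocks H s (inj₂ l) * blocks H t (inj₂ l))
                      ≡ (c + c) * identity (join n n s) (join n n t)
    blockRows (inj₁ a) (inj₁ b) = twice (_↑ˡ n) (↑ˡ-injective n _ _) a b
    blockRows (inj₁ a) (inj₂ b) = cancels a b (λ l → sym (neg-distribʳ-* (H a l) (H b l))) (↑ˡ≢↑ʳ a b)
    blockRows (inj₂ a) (inj₁ b) = cancels a b (λ l → sym (neg-distribˡ-* (H a l) (H b l))) (↑ˡ≢↑ʳ b a ∘ sym)
    blockRows (inj₂ a) (inj₂ b) = trans (cong (P a b +_) (Σℚ-cong n (λ l → neg*neg (H a l) (H b l))))
      (twice (n ↑ʳ_) (↑ʳ-injective n _ _) a b)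
      where
      neg*neg : ∀ x y → - x * - y ≡ x * y
      neg*neg = solve 2 (λ x y → :- x :* :- y := x :* y) refl
        where open ℚSolver

sylvesterOrder : ℕ → ℕ
sylvesterOrder zero    = 1
sylvesterOrder (suc k) = sylvesterOrder k ℕ.+ sylvesterOrder k

sylvester : ∀ k → Matrix (sylvesterOrder k)
sylvester zero    _ _ = 1ℚ
sylvester (suc k)     = doubled (sylvester k)

sylvesterOrder≡2^ : ∀ k → sylvesterOrder k ≡ 2 ^ k
sylvesterOrder≡2^ zero    = refl
sylvesterOrder≡2^ (suc k) = cong₂ ℕ._+_ ih (trans ih (sym (ℕₚ.+-identityʳ (2 ^ k))))
  where
  ih : sylvesterOrder k ≡ 2 ^ k
  ih = sylvesterOrder≡2^ k

sylvester-sign : ∀ k → IsSignMatrix (sylvester k)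
sylvester-sign zero    _ _ = inj₁ refl
sylvester-sign (suc k)     = doubled-sign (sylvester k) (sylvester-sign k)

sylvester-symmetric : ∀ k → IsSymmetric (sylvester k)
sylvester-symmetric zero    _ _ = refl
sylvester-symmetric (suc k)     = doubled-symmetric (sylvester k) (sylvester-symmetric k)

sylvester-orthogonal : ∀ k → HasOrthogonalRows (ι (sylvesterOrder k)) (sylvester k)
sylvester-orthogonal zero    zero zero = refl
sylvester-orthogonal (suc k) =
  subst (λ c → HasOrthogonalRows c (sylvester (suc k))) (sym (ι-homo-+ (sylvesterOrder k) (sylvesterOrder k)))
    (doubled-orthogonal (sylvester k) {ι (sylvesterOrder k)} (sylvester-orthogonal k))

sylvester-contains-1 : ∀ k → Contains 1ℚ (sylvester k)
sylvester-contains-1 zero    = zero , zero , refl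
sylvester-contains-1 (suc k) = doubled-contains-1 (sylvester k) (sylvester-contains-1 k)

sylvester-contains-−1 : ∀ {k} → 0 ℕ.< k → Contains (- 1ℚ) (sylvester k)
sylvester-contains-−1 {suc k} _ = doubled-contains-−1 (sylvester k) (sylvester-contains-1 k)

bordered : ∀ {n} → ℚ → Matrix n → Matrix (suc n)
bordered x H zero    zero    = 1ℚ
bordered x H zero    (suc j) = 0ℚ
bordered x H (suc i) zero    = 0ℚ
bordered x H (suc i) (suc j) = x * H i j

*-−1 : ∀ x → x * - 1ℚ ≡ - x
*-−1 x = trans (sym (neg-distribʳ-* x 1ℚ)) (cong -_ (*-identityʳ x))

*-sign : ∀ x {s} → IsSign s → x * s ≡ x ⊎ x * s ≡ - x
*-sign x (inj₁ refl) = inj₁ (*-identityʳ x)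
*-sign x (inj₂ refl) = inj₂ (*-−1 x)

module _ {n : ℕ} (x : ℚ) {H : Matrix n} where

  bordered-symmetric : IsSymmetric H → IsSymmetric (bordered x H)
  bordered-symmetric sym-H zero    zero    = refl
  bordered-symmetric sym-H zero    (suc j) = refl
  bordered-symmetric sym-H (suc i) zero    = refl
  bordered-symmetric sym-H (suc i) (suc j) = cong (x *_) (sym-H i j)

  bordered-bounded : IsSignMatrix H → ℚ.∣ x ∣ ℚ.≤ 1ℚ → ∀ i j → ℚ.∣ bordered x H i j ∣ ℚ.≤ 1ℚ
  bordered-bounded sign-H ∣x∣≤1 zero    zero    = ≤-refl
  bordered-bounded sign-H ∣x∣≤1 zero    (suc j) = nonNegative⁻¹ 1ℚ
  bordered-bounded sign-H ∣x∣≤1 (suc i) zero    = nonNegative⁻¹ 1ℚ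
  bordered-bounded sign-H ∣x∣≤1 (suc i) (suc j) with *-sign x (sign-H i j)
  ... | inj₁ xs≡x  = subst (λ y → ℚ.∣ y ∣ ℚ.≤ 1ℚ) (sym xs≡x) ∣x∣≤1
  ... | inj₂ xs≡-x =
    subst (λ y → ℚ.∣ y ∣ ℚ.≤ 1ℚ) (sym xs≡-x) (subst (ℚ._≤ 1ℚ) (sym (∣-p∣≡∣p∣ x)) ∣x∣≤1)

  bordered-orthogonal : ∀ {c} → HasOrthogonalRows c H → x * x * c ≡ 1ℚ →
                        HasOrthogonalRows 1ℚ (bordered x H)
  bordered-orthogonal     orth xxc≡1 zero    zero    = cong (1ℚ * 1ℚ +_) (Σℚ-zero n)
  bordered-orthogonal     orth xxc≡1 zero    (suc j) =
    cong (1ℚ * 0ℚ +_) (trans (Σℚ-cong n (λ l → *-zeroˡ (x * H j l))) (Σℚ-zero n))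
  bordered-orthogonal     orth xxc≡1 (suc i) zero    =
    cong (0ℚ * 1ℚ +_) (trans (Σℚ-cong n (λ l → *-zeroʳ (x * H i l))) (Σℚ-zero n))
  bordered-orthogonal {c} orth xxc≡1 (suc i) (suc j) = begin
    0ℚ * 0ℚ + Σℚ n (λ l → (x * H i l) * (x * H j l))  ≡⟨ +-identityˡ _ ⟩
    Σℚ n (λ l → (x * H i l) * (x * H j l))            ≡⟨ Σℚ-cong n (λ l → pull (H i l) (H j l)) ⟩
    Σℚ n (λ l → (x * x) * (H i l * H j l))            ≡⟨ Σℚ-*ˡ n (x * x) _ ⟩
    (x * x) * (H ⊗ transpose H) i j                    ≡⟨ cong ((x * x) *_) (orth i j) ⟩
    (x * x) * (c * identity i j)                       ≡⟨ *-assoc (x * x) c (identity i j) ⟨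
    (x * x * c) * identity i j                         ≡⟨ cong₂ _*_ xxc≡1 (sym (identity-suc i j)) ⟩
    1ℚ * identity (suc i) (suc j)                      ∎
    where
    open ≡-Reasoning
    identity-suc : ∀ i j → identity {suc n} (suc i) (suc j) ≡ identity i j
    identity-suc = identity-injective suc suc-injective
    pull : ∀ a b → (x * a) * (x * b) ≡ (x * x) * (a * b)
    pull a b = solve 3 (λ x a b → (x :* a) :* (x :* b) := (x :* x) :* (a :* b)) refl x a b
      where open ℚSolver

  bordered-cretan : ∀ {c} → IsSignMatrix H → IsSymmetric H → HasOrthogonalRows c H →
                    x * x * c ≡ 1ℚ → ℚ.∣ x ∣ ℚ.≤ 1ℚ → IsCretan 1ℚ (bordered x H)
  bordered-cretan sign-H sym-H orth xxc≡1 ∣x∣≤1 =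
    bordered-bounded sign-H ∣x∣≤1 , orth′ ,
    λ i j → trans (symmetric⇒ᵀ⊗≡⊗ᵀ (bordered-symmetric sym-H) i j) (orth′ i j)
    where
    orth′ : HasOrthogonalRows 1ℚ (bordered x H)
    orth′ = bordered-orthogonal orth xxc≡1

bordered-fourLevels : ∀ {n} m {H : Matrix n} → IsSignMatrix H → Contains 1ℚ H → Contains (- 1ℚ) H →
                      FourLevels m (bordered (inv2m m) H)
bordered-fourLevels m {H} sign-H (a , b , Hab≡1) (a′ , b′ , Ha′b′≡-1) =
  levels , (zero , suc a , refl) , (zero , zero , refl) ,
  (suc a , suc b , trans (cong (x *_) Hab≡1) (*-identityʳ x)) ,
  (suc a′ , suc b′ , trans (cong (x *_) Ha′b′≡-1) (*-−1 x))
  where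
  x : ℚ
  x = inv2m m
  levels : ∀ i j → let y = bordered x H i j in y ≡ 0ℚ ⊎ y ≡ 1ℚ ⊎ y ≡ x ⊎ y ≡ - x
  levels zero    zero    = inj₂ (inj₁ refl)
  levels zero    (suc j) = inj₁ refl
  levels (suc i) zero    = inj₁ refl
  levels (suc i) (suc j) = inj₂ (inj₂ (*-sign x (sign-H i j)))

corollary1 : (j : ℕ) → 1 ≤ j → (m : ℕ) → 4 ℕ.* (m ℕ.* m) ≡ 2 ^ (2 ^ j) →
    Σ (Matrix (fermat j)) (λ C → IsCretan 1ℚ C × FourLevels m C)
corollary1 j _ zero 0≡2^2^j = ⊥-elim (ℕₚ.<⇒≢ (ℕₚ.m^n>0 2 (2 ^ j)) 0≡2^2^j)
corollary1 j _ m@(suc k) 4m²≡2^2^j =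
  subst (λ n → Σ (Matrix n) (λ C → IsCretan 1ℚ C × FourLevels m C)) order+1≡fermat
    ( bordered x (sylvester K)
    , bordered-cretan x (sylvester-sign K) (sylvester-symmetric K) (sylvester-orthogonal K) xxc≡1 (∣inv2m∣≤1 m)
    , bordered-fourLevels m (sylvester-sign K) (sylvester-contains-1 K) (sylvester-contains-−1 (ℕₚ.m^n>0 2 j)))
  where
  K : ℕ
  K = 2 ^ j
  x : ℚ
  x = inv2m m
  xxc≡1 : x * x * ι (sylvesterOrder K) ≡ 1ℚ
  xxc≡1 = trans (cong (λ N → x * x * ι N) (trans (sylvesterOrder≡2^ K) (sym 4m²≡2^2^j))) (inv2m-square k)
  order+1≡fermat : suc (sylvesterOrder K) ≡ fermat j
  order+1≡fermat = trans (cong suc (sylvesterOrder≡2^ K)) (ℕₚ.+-comm 1 (2 ^ K))
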